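{- Let $t\in\mathcal T_n$ be a binary tree with left depth $\delta(t)=(\delta_0,\dots,\delta_n)$ and let $T=\Phi(t)$ be the corresponding plane tree, with multi-degree $d(T)=(d_0,\dots,d_n)$. Then $\delta_i=d_0+d_1+\cdots+d_i-i$ for all $i\in\{0,1,\dots,n\}$.
   Context: A binary tree is a rooted plane tree in which every node has $0$ or $2$ ordered children; $\mathcal T_n$ is the set of binary trees with $n+1$ leaves, labelled $0,\dots,n$ from left to right. For binary trees $s,t$, $s\wedge t$ is the binary tree with left subtree $s$ and right subtree $t$ at the root. The left depth $\delta_i(t)$ is the number of steps to a left child on the path from the root to leaf $i$, and $\delta(t)=(\delta_0(t),\dots,\delta_n(t))$. A plane tree is a rooted tree whose children at each node are linearly ordered; the degree of a node is its number of children. The nodes of a plane tree with $n+1$ nodes are labelled $v_0,\dots,v_n$ in pre-order (first the root, then recursively the subtrees of the root from left to right), and the multi-degree is $d(T)=(d_0,\dots,d_n)$ with $d_i$ the degree of $v_i$. The bijection $\Phi$ from binary trees with $n+1$ leaves to plane trees with $n+1$ nodes is defined recursively: $\Phi$ of a single leaf is a single node, and $\Phi(s\wedge t)$ is obtained from $\Phi(s)$ by attaching $\Phi(t)$ as a new rightmost subtree of the root. -}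

module Defs where

open import Data.Nat using (ℕ; zero; suc; _+_)
open import Data.List using (List; []; _∷_; _++_; map; take; length; [_])

data BinTree : Set where
  leaf : BinTree
  _∧_  : BinTree → BinTree → BinTree

leaves : BinTree → ℕ
leaves leaf = 1
leaves (s ∧ t) = leaves s + leaves t

-- T_n membership: t has n+1 leaves (handled in the statement)

-- Left depth vector δ(t), leaves listed left to right:
-- leaves of the left subtree gain one left step, those of the right subtree none.
leftDepth : BinTree → List ℕ
leftDepth leaf = 0 ∷ []
leftDepth (s ∧ t) = map suc (leftDepth s) ++ leftDepth t

data PlaneTree : Set where
  node : List PlaneTree → PlaneTree

mutual
  multiDegree : PlaneTree → List ℕ
  multiDegree (node ts) = length ts ∷ multiDegreeForest ts

  multiDegreeForest : List PlaneTree → List ℕ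
  multiDegreeForest [] = []
  multiDegreeForest (t ∷ ts) = multiDegree t ++ multiDegreeForest ts

Φ : BinTree → PlaneTree
Φ leaf = node []
Φ (s ∧ t) with Φ s
... | node ts = node (ts ++ [ Φ t ])

-- i-th entry of a list (0-indexed), default 0 out of range
-- (only used for in-range indices in the statement).
at : List ℕ → ℕ → ℕ
at [] _ = 0
at (x ∷ xs) zero = x
at (x ∷ xs) (suc i) = at xs i

-- Grafting Φ(t) as a new last subtree of Φ(s) adds one to the root degree and
-- appends d(Φ(t)); on the binary side, the leaves of s gain one left step and
-- those of t are appended unchanged.  For leaves of s the extra root child
-- matches the extra left step.  For the j-th leaf of t the prefix sum gains all
-- of d(Φ(s)) plus one, which is leaves s because a plane tree with m nodes has
-- m − 1 edges; this exactly compensates the shift of the index by leaves s.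
module Submission where

open import Defs
open import Data.Nat using (ℕ; zero; suc; _+_; _≤_; _<_; z≤n; s≤s)
open import Data.Nat.Properties using (+-assoc; +-comm; +-suc; +-cancelˡ-<; +-commutativeSemigroup)
open import Algebra.Properties.CommutativeSemigroup +-commutativeSemigroup using (x∙yz≈y∙xz)
open import Data.Nat.ListAction using (sum)
open import Data.Nat.ListAction.Properties using (sum-++)
open import Data.List using (List; []; _∷_; _++_; map; take; length; [_])
open import Data.List.Properties using (length-++; length-map; ++-assoc; ++-identityʳ)
open import Relation.Binary.PropositionalEquality
  using (_≡_; refl; sym; trans; cong; cong₂; subst; module ≡-Reasoning)

data IndexView (L : ℕ) : ℕ → Set where
  inside : ∀ {i} → i < L → IndexView L i
  beyond : ∀ j → IndexView L (L + j)

indexView : ∀ L i → IndexView L i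
indexView zero    i       = beyond i
indexView (suc L) zero    = inside (s≤s z≤n)
indexView (suc L) (suc i) with indexView L i
... | inside i<L = inside (s≤s i<L)
... | beyond j   = beyond j

at-++ˡ : ∀ xs ys {i} → i < length xs → at (xs ++ ys) i ≡ at xs i
at-++ˡ (x ∷ xs) ys {zero}  _         = refl
at-++ˡ (x ∷ xs) ys {suc i} (s≤s i<n) = at-++ˡ xs ys i<n

at-++ʳ : ∀ xs ys j → at (xs ++ ys) (length xs + j) ≡ at ys j
at-++ʳ []       ys j = refl
at-++ʳ (x ∷ xs) ys j = at-++ʳ xs ys j

at-map-suc : ∀ xs {i} → i < length xs → at (map suc xs) i ≡ suc (at xs i)
at-map-suc (x ∷ xs) {zero}  _         = refl
at-map-suc (x ∷ xs) {suc i} (s≤s i<n) = at-map-suc xs i<n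

take-++ˡ : ∀ (xs ys : List ℕ) {n} → n ≤ length xs → take n (xs ++ ys) ≡ take n xs
take-++ˡ xs       ys {zero}  _         = refl
take-++ˡ (x ∷ xs) ys {suc n} (s≤s n≤m) = cong (x ∷_) (take-++ˡ xs ys n≤m)

take-++ʳ : ∀ (xs ys : List ℕ) n → take (length xs + n) (xs ++ ys) ≡ xs ++ take n ys
take-++ʳ []       ys n = refl
take-++ʳ (x ∷ xs) ys n = cong (x ∷_) (take-++ʳ xs ys n)

incrementHead : List ℕ → List ℕ
incrementHead []       = []
incrementHead (x ∷ xs) = suc x ∷ xs

length-incrementHead : ∀ xs → length (incrementHead xs) ≡ length xs
length-incrementHead []       = refl
length-incrementHead (x ∷ xs) = refl

PrefixExcess : List ℕ → List ℕ → Set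
PrefixExcess δ d = ∀ i → i < length δ → at δ i + i ≡ sum (take (suc i) d)

-- The hypothesis 1 + Σ d = length d says that d is the degree sequence of a tree.
PrefixExcess-graft : ∀ {δs ds δt dt} →
  length δs ≡ length ds → suc (sum ds) ≡ length ds →
  PrefixExcess δs ds → PrefixExcess δt dt →
  PrefixExcess (map suc δs ++ δt) (incrementHead ds ++ dt)
PrefixExcess-graft {δs} {[]} _ () _ _
PrefixExcess-graft {δs} {h ∷ r} {δt} {dt} δs≡ds Σds≡ds excessˢ excessᵗ i i<n
  with indexView (length δs) i
... | inside i<L = begin
    at (map suc δs ++ δt) i + i   ≡⟨ cong (_+ i) (at-++ˡ (map suc δs) δt i<L′) ⟩
    at (map suc δs) i + i         ≡⟨ cong (_+ i) (at-map-suc δs i<L) ⟩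
    suc (at δs i + i)             ≡⟨ cong suc (excessˢ i i<L) ⟩
    suc h + sum (take i r)        ≡⟨ cong (λ xs → suc h + sum xs) (sym (take-++ˡ r dt i≤r)) ⟩
    suc h + sum (take i (r ++ dt)) ∎
  where
  open ≡-Reasoning
  i<L′ : i < length (map suc δs)
  i<L′ = subst (i <_) (sym (length-map suc δs)) i<L
  i≤r : i ≤ length r
  i≤r with s≤s i≤r ← subst (i <_) δs≡ds i<L = i≤r
... | beyond j = begin
    at (map suc δs ++ δt) (L + j) + (L + j)
      ≡⟨ cong (λ k → at (map suc δs ++ δt) (k + j) + (L + j)) (sym (length-map suc δs)) ⟩
    at (map suc δs ++ δt) (length (map suc δs) + j) + (L + j)
      ≡⟨ cong (_+ (L + j)) (at-++ʳ (map suc δs) δt j) ⟩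
    at δt j + (L + j)
      ≡⟨ x∙yz≈y∙xz (at δt j) L j ⟩
    L + (at δt j + j)
      ≡⟨ cong₂ _+_ (trans δs≡ds (sym Σds≡ds)) (excessᵗ j j<t) ⟩
    sum (suc h ∷ r) + sum (take (suc j) dt)
      ≡⟨ sym (sum-++ (suc h ∷ r) (take (suc j) dt)) ⟩
    sum ((suc h ∷ r) ++ take (suc j) dt)
      ≡⟨ cong sum (sym (take-++ʳ (suc h ∷ r) dt (suc j))) ⟩
    sum (take (length (h ∷ r) + suc j) ((suc h ∷ r) ++ dt))
      ≡⟨ cong (λ k → sum (take k ((suc h ∷ r) ++ dt))) (trans (+-suc _ j) (cong (λ k → suc (k + j)) (sym δs≡ds))) ⟩
    sum (take (suc (L + j)) ((suc h ∷ r) ++ dt)) ∎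
  where
  open ≡-Reasoning
  L = length δs
  j<t : j < length δt
  j<t = +-cancelˡ-< L j (length δt)
    (subst (L + j <_) (trans (length-++ (map suc δs)) (cong (_+ length δt) (length-map suc δs))) i<n)

multiDegreeForest-++ : ∀ ts us → multiDegreeForest (ts ++ us) ≡ multiDegreeForest ts ++ multiDegreeForest us
multiDegreeForest-++ []       us = refl
multiDegreeForest-++ (t ∷ ts) us = begin
  multiDegree t ++ multiDegreeForest (ts ++ us)                  ≡⟨ cong (multiDegree t ++_) (multiDegreeForest-++ ts us) ⟩
  multiDegree t ++ (multiDegreeForest ts ++ multiDegreeForest us) ≡⟨ sym (++-assoc (multiDegree t) _ _) ⟩
  (multiDegree t ++ multiDegreeForest ts) ++ multiDegreeForest us ∎
  where open ≡-Reasoning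

mutual
  suc-sum-multiDegree : ∀ T → suc (sum (multiDegree T)) ≡ length (multiDegree T)
  suc-sum-multiDegree (node ts) =
    cong suc (trans (+-comm (length ts) _) (sum-multiDegreeForest ts))

  sum-multiDegreeForest : ∀ ts → sum (multiDegreeForest ts) + length ts ≡ length (multiDegreeForest ts)
  sum-multiDegreeForest []       = refl
  sum-multiDegreeForest (t ∷ ts) = begin
    sum (multiDegree t ++ F) + suc (length ts)      ≡⟨ cong (_+ suc (length ts)) (sum-++ (multiDegree t) F) ⟩
    sum (multiDegree t) + sum F + suc (length ts)   ≡⟨ +-suc _ (length ts) ⟩
    suc (sum (multiDegree t) + sum F + length ts)   ≡⟨ cong suc (+-assoc (sum (multiDegree t)) (sum F) (length ts)) ⟩
    suc (sum (multiDegree t)) + (sum F + length ts) ≡⟨ cong₂ _+_ (suc-sum-multiDegree t) (sum-multiDegreeForest ts) ⟩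
    length (multiDegree t) + length F               ≡⟨ sym (length-++ (multiDegree t)) ⟩
    length (multiDegree t ++ F)                     ∎
    where
    open ≡-Reasoning
    F = multiDegreeForest ts

multiDegree-Φ-∧ : ∀ s t → multiDegree (Φ (s ∧ t)) ≡ incrementHead (multiDegree (Φ s)) ++ multiDegree (Φ t)
multiDegree-Φ-∧ s t with Φ s
... | node ts = cong₂ _∷_ (trans (length-++ ts) (+-comm (length ts) 1)) (begin
  multiDegreeForest (ts ++ [ Φ t ])                        ≡⟨ multiDegreeForest-++ ts [ Φ t ] ⟩
  multiDegreeForest ts ++ (multiDegree (Φ t) ++ [])        ≡⟨ cong (multiDegreeForest ts ++_) (++-identityʳ _) ⟩
  multiDegreeForest ts ++ multiDegree (Φ t)                ∎)
  where open ≡-Reasoning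

length-multiDegree-Φ : ∀ t → length (multiDegree (Φ t)) ≡ leaves t
length-multiDegree-Φ leaf    = refl
length-multiDegree-Φ (s ∧ t) = begin
  length (multiDegree (Φ (s ∧ t)))                                   ≡⟨ cong length (multiDegree-Φ-∧ s t) ⟩
  length (incrementHead (multiDegree (Φ s)) ++ multiDegree (Φ t))    ≡⟨ length-++ (incrementHead (multiDegree (Φ s))) ⟩
  length (incrementHead (multiDegree (Φ s))) + length (multiDegree (Φ t))
    ≡⟨ cong₂ _+_ (trans (length-incrementHead (multiDegree (Φ s))) (length-multiDegree-Φ s)) (length-multiDegree-Φ t) ⟩
  leaves s + leaves t                                                 ∎
  where open ≡-Reasoning

length-leftDepth : ∀ t → length (leftDepth t) ≡ leaves t
length-leftDepth leaf    = refl
length-leftDepth (s ∧ t) = trans (length-++ (map suc (leftDepth s)))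
  (cong₂ _+_ (trans (length-map suc (leftDepth s)) (length-leftDepth s)) (length-leftDepth t))

PrefixExcess-leftDepth-Φ : ∀ t → PrefixExcess (leftDepth t) (multiDegree (Φ t))
PrefixExcess-leftDepth-Φ leaf    zero    _        = refl
PrefixExcess-leftDepth-Φ leaf    (suc i) (s≤s ())
PrefixExcess-leftDepth-Φ (s ∧ t) = subst (PrefixExcess (leftDepth (s ∧ t))) (sym (multiDegree-Φ-∧ s t))
  (PrefixExcess-graft {leftDepth s} {multiDegree (Φ s)} {leftDepth t} {multiDegree (Φ t)}
                      (trans (length-leftDepth s) (sym (length-multiDegree-Φ s)))
                      (suc-sum-multiDegree (Φ s))
                      (PrefixExcess-leftDepth-Φ s) (PrefixExcess-leftDepth-Φ t))

proposition2p6 : (n : ℕ) (t : BinTree) → leaves t ≡ suc n →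
    (i : ℕ) → i ≤ n →
    at (leftDepth t) i + i ≡ sum (take (suc i) (multiDegree (Φ t)))
proposition2p6 n t leaves≡1+n i i≤n =
  PrefixExcess-leftDepth-Φ t i (subst (i <_) (sym (trans (length-leftDepth t) leaves≡1+n)) (s≤s i≤n))
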